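{- For each level $\ell$, the presheaf CwF $\widehat{\mathrm{BPCube}}$ supports a universe for $\mathrm{Ty}^{\mathrm{Disc}}_\ell$: there is a type $\Gamma\vdash\mathcal U^{\mathrm{NDD}}_\ell$ in every context $\Gamma$, stable under substitution, together with operations sending terms $\Gamma\vdash A:\mathcal U^{\mathrm{NDD}}_\ell$ to discrete types $\Gamma\vdash\mathrm{El}\,A$ of level $\ell$ and discrete types $\Gamma\vdash T$ of level $\ell$ to terms $\Gamma\vdash\ulcorner T\urcorner:\mathcal U^{\mathrm{NDD}}_\ell$, which are mutually inverse and commute with substitution.
   Context: $\mathrm{BPCube}$: pairs $W=(W_B,W_P)$ of disjoint finite sets of names; face maps assign to bridge variables values in $\{0,1\}\cup V_B$ and to path variables values in $\{0,1\}\cup V_B\cup V_P$; composition by substitution. Presheaf CwF on it as standard (types: sets $T[\gamma]$ with functorial restrictions). The metatheory has a chain of Grothendieck universes $\mathrm{Set}_0\in\mathrm{Set}_1\in\cdots$; a type $T$ has level $\ell$ if every $T[\gamma]\in\mathrm{Set}_\ell$. With $(W,i{:}\mathbb P)$ the extension by a fresh path variable and $(\setminus i)$ the weakening face map, elements are degenerate in $i$ if they are restrictions along $(\setminus i)$; a type $T$ is discrete if every $t\in T[\gamma]$ is degenerate in every path variable in which $\gamma$ is degenerate. $\mathrm{Ty}^{\mathrm{Disc}}_\ell(\Gamma)$ is the set of discrete types of level $\ell$ over $\Gamma$. -}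

module Defs where

open import Level using (Level; _⊔_; Setω) renaming (suc to lsuc)
open import Data.Nat using (ℕ; suc)
open import Data.Fin using (Fin; punchIn)
open import Data.Vec using (Vec; lookup; map; tabulate)
open import Data.Product using (Σ; Σ-syntax; _,_)
open import Relation.Binary.PropositionalEquality
open import Axiom.UniquenessOfIdentityProofs.WithK using (uip)

-- The category BPCube (skeletal presentation: bridge and path
-- variables are de Bruijn indices Fin nB / Fin nP).

record Obj : Set where
  constructor ⟨_∣_⟩
  field
    nB : ℕ
    nP : ℕ
open Obj public

data BVal (V : Obj) : Set where
  b0 b1 : BVal V
  bvar  : Fin (nB V) → BVal V

data PVal (V : Obj) : Set where
  p0 p1 : PVal V
  pbvar : Fin (nB V) → PVal V
  ppvar : Fin (nP V) → PVal V

-- a face map  V → W  assigns to every variable of W a value over V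
record Hom (V W : Obj) : Set where
  constructor hom
  field
    bmap : Vec (BVal V) (nB W)
    pmap : Vec (PVal V) (nP W)
open Hom public

b→p : ∀ {V} → BVal V → PVal V
b→p b0 = p0
b→p b1 = p1
b→p (bvar i) = pbvar i

substB : ∀ {U V} → Hom U V → BVal V → BVal U
substB g b0 = b0
substB g b1 = b1
substB g (bvar i) = lookup (bmap g) i

substP : ∀ {U V} → Hom U V → PVal V → PVal U
substP g p0 = p0
substP g p1 = p1
substP g (pbvar i) = b→p (lookup (bmap g) i)
substP g (ppvar i) = lookup (pmap g) i

_∘h_ : ∀ {U V W} → Hom V W → Hom U V → Hom U W
f ∘h g = hom (map (substB g) (bmap f)) (map (substP g) (pmap f))

idh : ∀ {W} → Hom W W
idh = hom (tabulate bvar) (tabulate ppvar)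

-- weakening face map (\ i) : (W , i : P) → W, where the fresh path
-- variable i sits at position i of ⟨ b ∣ suc n ⟩
wkP : ∀ {b n} (i : Fin (suc n)) → Hom ⟨ b ∣ suc n ⟩ ⟨ b ∣ n ⟩
wkP i = hom (tabulate bvar) (tabulate (λ j → ppvar (punchIn i j)))

coe : ∀ {a} {A B : Set a} → A ≡ B → A → B
coe = subst (λ X → X)

record Ctx (c : Level) : Set (lsuc c) where
  field
    ob     : Obj → Set c
    rst    : ∀ {V W} → Hom V W → ob W → ob V
    rst-id : ∀ {W} (γ : ob W) → rst idh γ ≡ γ
    rst-∘  : ∀ {U V W} (f : Hom V W) (g : Hom U V) (γ : ob W) →
             rst (f ∘h g) γ ≡ rst g (rst f γ)
open Ctx public

record Sub {d c} (Δ : Ctx d) (Γ : Ctx c) : Set (c ⊔ d) where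
  field
    fn  : ∀ {W} → ob Δ W → ob Γ W
    nat : ∀ {V W} (f : Hom V W) (δ : ob Δ W) → fn (rst Δ f δ) ≡ rst Γ f (fn δ)
open Sub public

record Ty {c} (Γ : Ctx c) (ℓ : Level) : Set (c ⊔ lsuc ℓ) where
  field
    ty      : (W : Obj) → ob Γ W → Set ℓ
    rstT    : ∀ {V W} (f : Hom V W) {γ : ob Γ W} → ty W γ → ty V (rst Γ f γ)
    rstT-id : ∀ {W} {γ : ob Γ W} (t : ty W γ) →
              subst (ty W) (rst-id Γ γ) (rstT idh t) ≡ t
    rstT-∘  : ∀ {U V W} (f : Hom V W) (g : Hom U V) {γ : ob Γ W} (t : ty W γ) →
              subst (ty U) (rst-∘ Γ f g γ) (rstT (f ∘h g) t) ≡ rstT g (rstT f t)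
open Ty public

record Tm {c ℓ} (Γ : Ctx c) (T : Ty Γ ℓ) : Set (c ⊔ ℓ) where
  field
    tm     : ∀ {W} (γ : ob Γ W) → ty T W γ
    tm-rst : ∀ {V W} (f : Hom V W) (γ : ob Γ W) → rstT T f (tm γ) ≡ tm (rst Γ f γ)
open Tm public

record _≅Ty_ {c ℓ} {Γ : Ctx c} (T T' : Ty Γ ℓ) : Set (c ⊔ lsuc ℓ) where
  field
    fib     : ∀ W (γ : ob Γ W) → ty T W γ ≡ ty T' W γ
    fib-rst : ∀ {V W} (f : Hom V W) {γ : ob Γ W} (t : ty T W γ) →
              coe (fib V (rst Γ f γ)) (rstT T f t) ≡ rstT T' f (coe (fib W γ) t)
open _≅Ty_ public

_≈Tm_ : ∀ {c ℓ} {Γ : Ctx c} {T : Ty Γ ℓ} → Tm Γ T → Tm Γ T → Set (c ⊔ ℓ)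
_≈Tm_ {Γ = Γ} t t' = ∀ W (γ : ob Γ W) → tm t γ ≡ tm t' γ

private
  subst-fn : ∀ {a b p} {A : Set a} {B : Set b} (P : B → Set p) (h : A → B)
             {x y : A} (e : x ≡ y) (u : P (h x)) →
             subst (λ z → P (h z)) e u ≡ subst P (cong h e) u
  subst-fn P h refl u = refl

  subst-app : ∀ {a b p q} {A : Set a} {B : Set b} {P : A → Set p} {Q : B → Set q}
              (h : A → B) (k : ∀ {x} → P x → Q (h x)) {x y : A} (e : x ≡ y) (u : P x) →
              k (subst P e u) ≡ subst Q (cong h e) (k u)
  subst-app h k refl u = refl

  subst-uip : ∀ {a p} {A : Set a} (P : A → Set p) {x y : A} (e e' : x ≡ y) (u : P x) →
              subst P e u ≡ subst P e' u
  subst-uip P e e' u = cong (λ z → subst P z u) (uip e e')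

  subst-dep : ∀ {a p} {A : Set a} {P : A → Set p} (k : (x : A) → P x) {x y : A}
              (e : x ≡ y) → subst P e (k x) ≡ k y
  subst-dep k refl = refl

_[_]T : ∀ {c d ℓ} {Γ : Ctx c} {Δ : Ctx d} → Ty Γ ℓ → Sub Δ Γ → Ty Δ ℓ
_[_]T {Γ = Γ} {Δ} T σ = record
  { ty      = λ W δ → ty T W (fn σ δ)
  ; rstT    = λ {V} f {δ} t → subst (ty T V) (sym (nat σ f δ)) (rstT T f t)
  ; rstT-id = λ {W} {δ} t →
      trans (subst-fn (ty T W) (fn σ) (rst-id Δ δ) _)
      (trans (subst-subst {P = ty T W} (sym (nat σ idh δ)) {cong (fn σ) (rst-id Δ δ)})
      (trans (subst-uip (ty T W) _ (rst-id Γ (fn σ δ)) (rstT T idh t))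
             (rstT-id T t)))
  ; rstT-∘  = λ {U} {V} {W} f g {δ} t →
      trans (subst-fn (ty T U) (fn σ) (rst-∘ Δ f g δ) _)
      (trans (subst-subst {P = ty T U} (sym (nat σ (f ∘h g) δ)) {cong (fn σ) (rst-∘ Δ f g δ)})
      (trans (subst-uip (ty T U) _
               (trans (rst-∘ Γ f g (fn σ δ))
                 (trans (cong (rst Γ g) (sym (nat σ f δ))) (sym (nat σ g (rst Δ f δ)))))
               (rstT T (f ∘h g) t))
      (trans (sym (subst-subst (rst-∘ Γ f g (fn σ δ))))
      (trans (cong (subst (ty T U) _) (rstT-∘ T f g t))
      (trans (sym (subst-subst (cong (rst Γ g) (sym (nat σ f δ)))))
             (cong (subst (ty T U) (sym (nat σ g (rst Δ f δ))))
                   (sym (subst-app (rst Γ g) (rstT T g) (sym (nat σ f δ)) (rstT T f t)))))))))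
  }

_[_]t : ∀ {c d ℓ} {Γ : Ctx c} {Δ : Ctx d} {T : Ty Γ ℓ} → Tm Γ T → (σ : Sub Δ Γ) → Tm Δ (T [ σ ]T)
_[_]t {T = T} t σ = record
  { tm     = λ δ → tm t (fn σ δ)
  ; tm-rst = λ {V} f δ →
      trans (cong (subst (ty T V) (sym (nat σ f δ))) (tm-rst t f (fn σ δ)))
            (subst-dep (tm t) (sym (nat σ f δ)))
  }

transp : ∀ {c ℓ} {Γ : Ctx c} {T T' : Ty Γ ℓ} → Tm Γ T → T ≅Ty T' → Tm Γ T'
transp {Γ = Γ} t e = record
  { tm     = λ {W} γ → coe (fib e W γ) (tm t γ)
  ; tm-rst = λ {V} f γ →
      trans (sym (fib-rst e f (tm t γ))) (cong (coe (fib e V (rst Γ f γ))) (tm-rst t f γ))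
  }

DegCtx : ∀ {c} (Γ : Ctx c) {b n} (i : Fin (suc n)) → ob Γ ⟨ b ∣ suc n ⟩ → Set c
DegCtx Γ {b} {n} i γ = Σ[ γ' ∈ ob Γ ⟨ b ∣ n ⟩ ] rst Γ (wkP i) γ' ≡ γ

DegTy : ∀ {c ℓ} {Γ : Ctx c} (T : Ty Γ ℓ) {b n} (i : Fin (suc n))
        {γ : ob Γ ⟨ b ∣ suc n ⟩} → ty T ⟨ b ∣ suc n ⟩ γ → Set (c ⊔ ℓ)
DegTy {Γ = Γ} T {b} {n} i {γ} t =
  Σ[ γ' ∈ ob Γ ⟨ b ∣ n ⟩ ] Σ[ e ∈ rst Γ (wkP i) γ' ≡ γ ]
  Σ[ t' ∈ ty T ⟨ b ∣ n ⟩ γ' ] subst (ty T ⟨ b ∣ suc n ⟩) e (rstT T (wkP i) t') ≡ t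

Discrete : ∀ {c ℓ} {Γ : Ctx c} → Ty Γ ℓ → Set (c ⊔ ℓ)
Discrete {Γ = Γ} T =
  ∀ {b n} (i : Fin (suc n)) (γ : ob Γ ⟨ b ∣ suc n ⟩) → DegCtx Γ i γ →
  (t : ty T ⟨ b ∣ suc n ⟩ γ) → DegTy T i t

record DiscUniverse (ℓ : Level) : Setω where
  field
    uℓ       : Level
    U        : ∀ {c} (Γ : Ctx c) → Ty Γ uℓ
    U-sub    : ∀ {c d} {Γ : Ctx c} {Δ : Ctx d} (σ : Sub Δ Γ) → (U Γ [ σ ]T) ≅Ty U Δ
    El       : ∀ {c} {Γ : Ctx c} → Tm Γ (U Γ) → Ty Γ ℓ
    El-disc  : ∀ {c} {Γ : Ctx c} (A : Tm Γ (U Γ)) → Discrete (El A)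
    code     : ∀ {c} {Γ : Ctx c} (T : Ty Γ ℓ) → Discrete T → Tm Γ (U Γ)
    El-code  : ∀ {c} {Γ : Ctx c} (T : Ty Γ ℓ) (d : Discrete T) → El (code T d) ≅Ty T
    code-El  : ∀ {c} {Γ : Ctx c} (A : Tm Γ (U Γ)) → code (El A) (El-disc A) ≈Tm A
    El-sub   : ∀ {c d} {Γ : Ctx c} {Δ : Ctx d} (σ : Sub Δ Γ) (A : Tm Γ (U Γ)) →
               (El A [ σ ]T) ≅Ty El (transp (A [ σ ]t) (U-sub σ))
    code-sub : ∀ {c d} {Γ : Ctx c} {Δ : Ctx d} (σ : Sub Δ Γ) (T : Ty Γ ℓ)
               (dT : Discrete T) (dTσ : Discrete (T [ σ ]T)) →
               transp (code T dT [ σ ]t) (U-sub σ) ≈Tm code (T [ σ ]T) dTσ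

module Submission where

-- The universe of discrete types is the Hofmann–Streicher universe cut down
-- to discrete types: U(W) consists of the discrete types of level ℓ over the
-- representable presheaf y W, restriction along f is reindexing along y f,
-- El A at γ is the fibre of the type A(γ) over the identity of W, and the
-- code of T at γ is T reindexed along the classifying map χ γ : y W → Γ.
--
-- For U(W) to have equality given by equality of the underlying types,
-- 'Discrete' (which carries witnesses) is replaced by the equivalent
-- proposition 'DegFixed': every element over a point degenerate in the path
-- variable i is fixed by restricting along the section (i := 0) and then
-- back along the weakening (\ i).

open import Defs
open import Level using (Level)
open import Axiom.Extensionality.Propositional using (Extensionality)
open import Level using (_⊔_; 0ℓ) renaming (suc to lsuc)
open import Axiom.Extensionality.Propositional using (ExtensionalityImplicit; implicit-extensionality)
open import Axiom.UniquenessOfIdentityProofs.WithK using (uip)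
open import Data.Fin using (Fin)
open import Data.Nat using (suc)
open import Data.Product using (Σ; _,_; proj₁; proj₂)
open import Function using (_∋_)
open import Data.Vec using (lookup; tabulate; insertAt)
open import Data.Vec.Properties using (map-id; map-cong; map-∘; lookup-map; lookup∘tabulate; tabulate-∘; tabulate∘lookup; tabulate-cong; insertAt-punchIn)
open import Relation.Binary.PropositionalEquality
open import Relation.Binary.HeterogeneousEquality as H using (_≅_; ≅-to-≡; ≡-to-≅; ≡-subst-removable; ≅-irrelevant)

substB-id : ∀ {W} (x : BVal W) → substB idh x ≡ x
substB-id b0       = refl
substB-id b1       = refl
substB-id (bvar i) = lookup∘tabulate bvar i

substP-id : ∀ {W} (x : PVal W) → substP idh x ≡ x
substP-id p0        = refl
substP-id p1        = refl
substP-id (pbvar i) = cong b→p (lookup∘tabulate bvar i)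
substP-id (ppvar i) = lookup∘tabulate ppvar i

substB-∘ : ∀ {U V W} (g : Hom V W) (h : Hom U V) (x : BVal W) →
           substB h (substB g x) ≡ substB (g ∘h h) x
substB-∘ g h b0       = refl
substB-∘ g h b1       = refl
substB-∘ g h (bvar i) = sym (lookup-map i (substB h) (bmap g))

b→p-subst : ∀ {U V} (h : Hom U V) (x : BVal V) → substP h (b→p x) ≡ b→p (substB h x)
b→p-subst h b0       = refl
b→p-subst h b1       = refl
b→p-subst h (bvar i) = refl

substP-∘ : ∀ {U V W} (g : Hom V W) (h : Hom U V) (x : PVal W) →
           substP h (substP g x) ≡ substP (g ∘h h) x
substP-∘ g h p0        = refl
substP-∘ g h p1        = refl
substP-∘ g h (pbvar i) = trans (b→p-subst h (lookup (bmap g) i))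
                               (cong b→p (sym (lookup-map i (substB h) (bmap g))))
substP-∘ g h (ppvar i) = sym (lookup-map i (substP h) (pmap g))

∘h-identityʳ : ∀ {V W} (f : Hom V W) → f ∘h idh ≡ f
∘h-identityʳ (hom b p) = cong₂ hom (trans (map-cong substB-id b) (map-id b))
                                   (trans (map-cong substP-id p) (map-id p))

∘h-identityˡ : ∀ {V W} (f : Hom V W) → idh ∘h f ≡ f
∘h-identityˡ f@(hom b p) = cong₂ hom (trans (sym (tabulate-∘ (substB f) bvar)) (tabulate∘lookup b))
                                     (trans (sym (tabulate-∘ (substP f) ppvar)) (tabulate∘lookup p))

∘h-assoc : ∀ {T U V W} (f : Hom V W) (g : Hom U V) (h : Hom T U) →
           (f ∘h g) ∘h h ≡ f ∘h (g ∘h h)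
∘h-assoc (hom b p) g h = cong₂ hom
  (trans (sym (map-∘ (substB h) (substB g) b)) (map-cong (substB-∘ g h) b))
  (trans (sym (map-∘ (substP h) (substP g) p)) (map-cong (substP-∘ g h) p))

idh-commutes : ∀ {V W} (f : Hom V W) → idh ∘h f ≡ f ∘h idh
idh-commutes f = trans (∘h-identityˡ f) (sym (∘h-identityʳ f))

secP : ∀ {b n} (i : Fin (suc n)) → Hom ⟨ b ∣ n ⟩ ⟨ b ∣ suc n ⟩
secP i = hom (tabulate bvar) (insertAt (tabulate ppvar) i p0)

wk∘sec : ∀ {b n} (i : Fin (suc n)) → wkP {b} {n} i ∘h secP i ≡ idh
wk∘sec i = cong₂ hom
  (trans (sym (tabulate-∘ (substB (secP i)) bvar)) (tabulate∘lookup (tabulate bvar)))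
  (trans (sym (tabulate-∘ (substP (secP i)) _))
         (trans (tabulate-cong (insertAt-punchIn (tabulate ppvar) i p0)) (tabulate∘lookup (tabulate ppvar))))

rst-sec-wk : ∀ {c} (Γ : Ctx c) {b n} (i : Fin (suc n)) (γ : ob Γ ⟨ b ∣ n ⟩) →
             rst Γ (secP i) (rst Γ (wkP i) γ) ≡ γ
rst-sec-wk Γ i γ = begin
  rst Γ (secP i) (rst Γ (wkP i) γ) ≡⟨ rst-∘ Γ (wkP i) (secP i) γ ⟨
  rst Γ (wkP i ∘h secP i) γ        ≡⟨ cong (λ h → rst Γ h γ) (wk∘sec i) ⟩
  rst Γ idh γ                      ≡⟨ rst-id Γ γ ⟩
  γ                                ∎
  where open ≡-Reasoning

subst-const : ∀ {a b} {A : Set a} {B : Set b} {x y : A} (e : x ≡ y) (z : B) → subst (λ _ → B) e z ≡ z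
subst-const refl z = refl

rstT-cong : ∀ {c ℓ} {Γ : Ctx c} (T : Ty Γ ℓ) {V W} (f : Hom V W) {γ γ' : ob Γ W}
            {t : ty T W γ} {t' : ty T W γ'} → γ ≡ γ' → t ≅ t' → rstT T f t ≅ rstT T f t'
rstT-cong T f refl H.refl = H.refl

rstT-cong-ty : ∀ {c ℓ} {Γ : Ctx c} {T T' : Ty Γ ℓ} {V W} (f : Hom V W) {γ : ob Γ W}
               {t : ty T W γ} {t' : ty T' W γ} → T ≡ T' → t ≅ t' → rstT T f t ≅ rstT T' f t'
rstT-cong-ty f refl H.refl = H.refl

rstT-cong-hom : ∀ {c ℓ} {Γ : Ctx c} (T : Ty Γ ℓ) {V W} {f f' : Hom V W} {γ : ob Γ W} →
                f ≡ f' → (t : ty T W γ) → rstT T f t ≅ rstT T f' t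
rstT-cong-hom T refl t = H.refl

rstT-id≅ : ∀ {c ℓ} {Γ : Ctx c} (T : Ty Γ ℓ) {W} {γ : ob Γ W} (t : ty T W γ) → rstT T idh t ≅ t
rstT-id≅ {Γ = Γ} T {W} {γ} t =
  H.trans (H.sym (≡-subst-removable (ty T W) (rst-id Γ γ) _)) (≡-to-≅ (rstT-id T t))

rstT-∘≅ : ∀ {c ℓ} {Γ : Ctx c} (T : Ty Γ ℓ) {U V W} (f : Hom V W) (g : Hom U V) {γ : ob Γ W}
          (t : ty T W γ) → rstT T (f ∘h g) t ≅ rstT T g (rstT T f t)
rstT-∘≅ {Γ = Γ} T {U} f g {γ} t =
  H.trans (H.sym (≡-subst-removable (ty T U) (rst-∘ Γ f g γ) _)) (≡-to-≅ (rstT-∘ T f g t))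

rstT-sec-wk : ∀ {c ℓ} {Γ : Ctx c} (T : Ty Γ ℓ) {b n} (i : Fin (suc n)) {γ : ob Γ ⟨ b ∣ n ⟩}
              (t : ty T ⟨ b ∣ n ⟩ γ) → rstT T (secP i) (rstT T (wkP i) t) ≅ t
rstT-sec-wk T i t = begin
  rstT T (secP i) (rstT T (wkP i) t) ≅⟨ rstT-∘≅ T (wkP i) (secP i) t ⟨
  rstT T (wkP i ∘h secP i) t         ≅⟨ rstT-cong-hom T (wk∘sec i) t ⟩
  rstT T idh t                       ≅⟨ rstT-id≅ T t ⟩
  t                                  ∎
  where open H.≅-Reasoning

rstT-[]≅ : ∀ {c d ℓ} {Γ : Ctx c} {Δ : Ctx d} (T : Ty Γ ℓ) (σ : Sub Δ Γ) {V W} (f : Hom V W)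
           {δ : ob Δ W} (t : ty T W (fn σ δ)) → rstT (T [ σ ]T) f t ≅ rstT T f t
rstT-[]≅ T σ {V} f {δ} t = ≡-subst-removable (ty T V) (sym (nat σ f δ)) _

FixedAt : ∀ {c ℓ} {Γ : Ctx c} (T : Ty Γ ℓ) {b n} (i : Fin (suc n)) → ob Γ ⟨ b ∣ suc n ⟩ → Set ℓ
FixedAt T {b} {n} i γ = ∀ (t : ty T ⟨ b ∣ suc n ⟩ γ) → rstT T (wkP i) (rstT T (secP i) t) ≅ t

DegFixed : ∀ {c ℓ} {Γ : Ctx c} → Ty Γ ℓ → Set (c ⊔ ℓ)
DegFixed {Γ = Γ} T = ∀ {b n} (i : Fin (suc n)) (γ : ob Γ ⟨ b ∣ suc n ⟩) → DegCtx Γ i γ → FixedAt T i γ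

-- A degenerate element t = (\ i)·t' is fixed, since (i := 0)·t = t'.
discrete⇒degFixed : ∀ {c ℓ} {Γ : Ctx c} (T : Ty Γ ℓ) → Discrete T → DegFixed T
discrete⇒degFixed {Γ = Γ} T discrete {b} {n} i γ deg t = degenerate⇒fixed (discrete i γ deg t)
  where
  degenerate⇒fixed : ∀ {γ} {t : ty T ⟨ b ∣ suc n ⟩ γ} → DegTy T i t →
                     rstT T (wkP i) (rstT T (secP i) t) ≅ t
  degenerate⇒fixed (γ' , refl , t' , refl) =
    rstT-cong T (wkP i) (rst-sec-wk Γ i γ') (rstT-sec-wk T i t')

-- Conversely a fixed element is the degeneration of its restriction along (i := 0).
degFixed⇒discrete : ∀ {c ℓ} {Γ : Ctx c} (T : Ty Γ ℓ) → DegFixed T → Discrete T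
degFixed⇒discrete {Γ = Γ} T fixed {b} i .(rst Γ (wkP i) γ') (γ' , refl) t =
  γ' , refl , t' , ≅-to-≡ (begin
    rstT T (wkP i) t'                     ≅⟨ rstT-cong T (wkP i) (sym (rst-sec-wk Γ i γ')) t'≅ ⟩
    rstT T (wkP i) (rstT T (secP i) t)    ≅⟨ fixed i _ (γ' , refl) t ⟩
    t                                     ∎)
  where
  open H.≅-Reasoning
  t' : ty T ⟨ b ∣ _ ⟩ γ'
  t' = subst (ty T _) (rst-sec-wk Γ i γ') (rstT T (secP i) t)
  t'≅ : t' ≅ rstT T (secP i) t
  t'≅ = ≡-subst-removable (ty T _) (rst-sec-wk Γ i γ') _

FixedAt-sub : ∀ {c d ℓ} {Γ : Ctx c} {Δ : Ctx d} (σ : Sub Δ Γ) (T : Ty Γ ℓ) {b n} {i : Fin (suc n)}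
              {δ : ob Δ ⟨ b ∣ suc n ⟩} → FixedAt T i (fn σ δ) → FixedAt (T [ σ ]T) i δ
FixedAt-sub σ T {i = i} {δ} fixed t = begin
  rstT (T [ σ ]T) (wkP i) (rstT (T [ σ ]T) (secP i) t) ≅⟨ rstT-[]≅ T σ (wkP i) _ ⟩
  rstT T (wkP i) (rstT (T [ σ ]T) (secP i) t)          ≅⟨ rstT-cong T (wkP i) (nat σ (secP i) δ) (rstT-[]≅ T σ (secP i) t) ⟩
  rstT T (wkP i) (rstT T (secP i) t)                   ≅⟨ fixed t ⟩
  t                                                    ∎
  where open H.≅-Reasoning

DegCtx-sub : ∀ {c d} {Γ : Ctx c} {Δ : Ctx d} (σ : Sub Δ Γ) {b n} {i : Fin (suc n)}
             {δ : ob Δ ⟨ b ∣ suc n ⟩} → DegCtx Δ i δ → DegCtx Γ i (fn σ δ)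
DegCtx-sub σ {i = i} (δ' , e) = fn σ δ' , trans (sym (nat σ (wkP i) δ')) (cong (fn σ) e)

DegFixed-sub : ∀ {c d ℓ} {Γ : Ctx c} {Δ : Ctx d} (σ : Sub Δ Γ) (T : Ty Γ ℓ) →
               DegFixed T → DegFixed (T [ σ ]T)
DegFixed-sub σ T fixed i δ deg = FixedAt-sub σ T (fixed i (fn σ δ) (DegCtx-sub σ deg))

Y : Obj → Ctx 0ℓ
Y W = record
  { ob     = λ V → Hom V W
  ; rst    = λ f g → g ∘h f
  ; rst-id = ∘h-identityʳ
  ; rst-∘  = λ f g h → sym (∘h-assoc h f g)
  }

yf : ∀ {V W} → Hom V W → Sub (Y V) (Y W)
yf f = record { fn = f ∘h_ ; nat = λ h g → sym (∘h-assoc f g h) }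

χ : ∀ {c} {Γ : Ctx c} {W} → ob Γ W → Sub (Y W) Γ
χ {Γ = Γ} γ = record { fn = λ g → rst Γ g γ ; nat = λ h g → rst-∘ Γ g h γ }

idS : ∀ {c} {Γ : Ctx c} → Sub Γ Γ
idS = record { fn = λ γ → γ ; nat = λ f γ → refl }

_∘s_ : ∀ {c d e} {Γ : Ctx c} {Δ : Ctx d} {Θ : Ctx e} → Sub Δ Γ → Sub Θ Δ → Sub Θ Γ
σ ∘s τ = record { fn = λ θ → fn σ (fn τ θ) ; nat = λ f θ → trans (cong (fn σ) (nat τ f θ)) (nat σ f (fn τ θ)) }

-- Function extensionality lets us compare types, which are records of
-- functions, and prove that 'DegFixed' is a proposition.
module WithExtensionality (ext : ∀ {a b} → Extensionality a b) where

  iext : ∀ {a b} → ExtensionalityImplicit a b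
  iext {a} {b} = implicit-extensionality {a} {b} ext

  RstMap : ∀ {c ℓ} (Γ : Ctx c) → ((W : Obj) → ob Γ W → Set ℓ) → Set (c ⊔ ℓ)
  RstMap Γ A = ∀ {V W} (f : Hom V W) {γ : ob Γ W} → A W γ → A V (rst Γ f γ)

  IdLaw : ∀ {c ℓ} (Γ : Ctx c) (A : (W : Obj) → ob Γ W → Set ℓ) → RstMap Γ A → Set (c ⊔ ℓ)
  IdLaw Γ A r = ∀ {W} {γ : ob Γ W} (t : A W γ) → subst (A W) (rst-id Γ γ) (r idh t) ≡ t

  CompLaw : ∀ {c ℓ} (Γ : Ctx c) (A : (W : Obj) → ob Γ W → Set ℓ) → RstMap Γ A → Set (c ⊔ ℓ)
  CompLaw Γ A r = ∀ {U V W} (f : Hom V W) (g : Hom U V) {γ : ob Γ W} (t : A W γ) →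
                  subst (A U) (rst-∘ Γ f g γ) (r (f ∘h g) t) ≡ r g (r f t)

  -- Two types are equal when their fibres are equal and their restriction
  -- maps agree on heterogeneously equal elements; the functor laws are
  -- propositions by UIP.
  Ty-≡ : ∀ {c ℓ} {Γ : Ctx c} {T T' : Ty Γ ℓ} →
         (∀ W γ → ty T W γ ≡ ty T' W γ) →
         (∀ {V W} (f : Hom V W) {γ : ob Γ W} (t : ty T W γ) (t' : ty T' W γ) → t ≅ t' → rstT T f t ≅ rstT T' f t') →
         T ≡ T'
  Ty-≡ {Γ = Γ} {record { ty = A ; rstT = r ; rstT-id = ri ; rstT-∘ = rc }}
               {record { ty = A' ; rstT = r' ; rstT-id = ri' ; rstT-∘ = rc' }} fib-eq rst-eq
    with ext (λ W → ext (fib-eq W))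
  ... | refl with (_≡_ {A = RstMap Γ A} r r' ∋ iext (iext (ext λ f → iext (ext λ t → ≅-to-≡ (rst-eq f t t H.refl)))))
  ... | refl = cong₂ (λ (ri″ : IdLaw Γ A r) (rc″ : CompLaw Γ A r) → record { ty = A ; rstT = r ; rstT-id = ri″ ; rstT-∘ = rc″ })
                     (iext (iext (ext (λ t → uip (ri t) (ri' t)))))
                     (iext (iext (iext (ext (λ f → ext (λ g → iext (ext (λ t → uip (rc f g t) (rc' f g t)))))))))

  []-cong : ∀ {c d ℓ} {Γ : Ctx c} {Δ : Ctx d} (T : Ty Γ ℓ) {σ τ : Sub Δ Γ} →
            (∀ {W} (δ : ob Δ W) → fn σ δ ≡ fn τ δ) → T [ σ ]T ≡ T [ τ ]T
  []-cong T {σ} {τ} e = Ty-≡ (λ W δ → cong (ty T W) (e δ)) λ f {δ} t t' t≅t' →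
    H.trans (rstT-[]≅ T σ f t) (H.trans (rstT-cong T f (e δ) t≅t') (H.sym (rstT-[]≅ T τ f t')))

  []-id : ∀ {c ℓ} {Γ : Ctx c} (T : Ty Γ ℓ) → T [ idS ]T ≡ T
  []-id T = Ty-≡ (λ W γ → refl) λ f t t' t≅t' →
    H.trans (rstT-[]≅ T idS f t) (rstT-cong T f refl t≅t')

  []-∘ : ∀ {c d e ℓ} {Γ : Ctx c} {Δ : Ctx d} {Θ : Ctx e} (T : Ty Γ ℓ) (σ : Sub Δ Γ) (τ : Sub Θ Δ) →
         T [ σ ∘s τ ]T ≡ T [ σ ]T [ τ ]T
  []-∘ T σ τ = Ty-≡ (λ W θ → refl) λ f {θ} t t' t≅t' →
    H.trans (rstT-[]≅ T (σ ∘s τ) f t)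
    (H.trans (rstT-cong T f refl t≅t')
    (H.sym (H.trans (rstT-[]≅ (T [ σ ]T) τ f t') (rstT-[]≅ T σ f t'))))

  -- 'DegFixed' is a proposition, since heterogeneous equality is (by K).
  DegFixed-irrelevant : ∀ {c ℓ} {Γ : Ctx c} {T : Ty Γ ℓ} (p q : DegFixed T) →
                        _≡_ {A = DegFixed T} p q
  DegFixed-irrelevant p q =
    iext (iext (ext λ i → ext λ γ → ext λ deg → ext λ t → ≅-irrelevant (p i γ deg t) (q i γ deg t)))

  module Universe (ℓ : Level) where

    DiscTyʸ : Obj → Set (lsuc ℓ)
    DiscTyʸ W = Σ (Ty (Y W) ℓ) DegFixed

    DiscTyʸ-≡ : ∀ {W} {X X' : DiscTyʸ W} → proj₁ X ≡ proj₁ X' → X ≡ X'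
    DiscTyʸ-≡ {X = T , p} {.T , q} refl = cong (T ,_) (DegFixed-irrelevant {T = T} p q)

    reindex : ∀ {V W} → Hom V W → DiscTyʸ W → DiscTyʸ V
    reindex f X = proj₁ X [ yf f ]T , DegFixed-sub (yf f) (proj₁ X) (proj₂ X)

    reindex-id : ∀ {W} (X : DiscTyʸ W) → reindex idh X ≡ X
    reindex-id X = DiscTyʸ-≡ (trans ([]-cong (proj₁ X) ∘h-identityˡ) ([]-id (proj₁ X)))

    reindex-∘ : ∀ {U V W} (f : Hom V W) (g : Hom U V) (X : DiscTyʸ W) →
                reindex (f ∘h g) X ≡ reindex g (reindex f X)
    reindex-∘ f g X =
      DiscTyʸ-≡ (trans ([]-cong (proj₁ X) (∘h-assoc f g)) ([]-∘ (proj₁ X) (yf f) (yf g)))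

    -- U is the same closed presheaf in every context, hence stable under substitution.
    U : ∀ {c} (Γ : Ctx c) → Ty Γ (lsuc ℓ)
    U Γ = record
      { ty      = λ W _ → DiscTyʸ W
      ; rstT    = λ f X → reindex f X
      ; rstT-id = λ {W} {γ} X → trans (subst-const (rst-id Γ γ) _) (reindex-id X)
      ; rstT-∘  = λ f g {γ} X → trans (subst-const (rst-∘ Γ f g γ) _) (reindex-∘ f g X)
      }

    U-sub : ∀ {c d} {Γ : Ctx c} {Δ : Ctx d} (σ : Sub Δ Γ) → (U Γ [ σ ]T) ≅Ty U Δ
    U-sub σ = record { fib = λ W δ → refl ; fib-rst = λ f {δ} X → subst-const (sym (nat σ f δ)) _ }

    module _ {c} {Γ : Ctx c} (A : Tm Γ (U Γ)) where

      A∣ : ∀ {W} → ob Γ W → Ty (Y W) ℓ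
      A∣ γ = proj₁ (tm A γ)

      A∣-rst : ∀ {V W} (f : Hom V W) (γ : ob Γ W) → A∣ (rst Γ f γ) ≡ A∣ γ [ yf f ]T
      A∣-rst f γ = cong proj₁ (sym (tm-rst A f γ))

      -- The fibre of El A at γ is A∣ γ over the identity; restriction along f
      -- is restriction in A∣ γ, moved from the point idh ∘h f to f ∘h idh and
      -- then along naturality of A.
      El-rst : ∀ {V W} (f : Hom V W) {γ : ob Γ W} → ty (A∣ γ) W idh → ty (A∣ (rst Γ f γ)) V idh
      El-rst {V} f {γ} t = subst (λ T → ty T V idh) (sym (A∣-rst f γ))
                                 (subst (ty (A∣ γ) V) (idh-commutes f) (rstT (A∣ γ) f t))

      El-rst≅ : ∀ {V W} (f : Hom V W) {γ : ob Γ W} (t : ty (A∣ γ) W idh) → El-rst f t ≅ rstT (A∣ γ) f t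
      El-rst≅ {V} f {γ} t = H.trans (≡-subst-removable (λ T → ty T V idh) (sym (A∣-rst f γ)) _)
                                    (≡-subst-removable (ty (A∣ γ) V) (idh-commutes f) _)

      El-rst-rst : ∀ {U V W} (f : Hom V W) (g : Hom U V) {γ : ob Γ W} (t : ty (A∣ γ) W idh) →
                   El-rst g (El-rst f t) ≅ rstT (A∣ γ) g (rstT (A∣ γ) f t)
      El-rst-rst {V = V} f g {γ} t = begin
        El-rst g (El-rst f t)                 ≅⟨ El-rst≅ g (El-rst f t) ⟩
        rstT (A∣ (rst Γ f γ)) g (El-rst f t)  ≅⟨ rstT-cong-ty g (A∣-rst f γ) (≡-subst-removable (λ T → ty T V idh) (sym (A∣-rst f γ)) _) ⟩
        rstT (A∣ γ [ yf f ]T) g t₁            ≅⟨ rstT-[]≅ (A∣ γ) (yf f) g t₁ ⟩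
        rstT (A∣ γ) g t₁                      ≅⟨ rstT-cong (A∣ γ) g (sym (idh-commutes f)) (≡-subst-removable (ty (A∣ γ) V) (idh-commutes f) _) ⟩
        rstT (A∣ γ) g (rstT (A∣ γ) f t)       ∎
        where
        open H.≅-Reasoning
        t₁ : ty (A∣ γ [ yf f ]T) V idh
        t₁ = subst (ty (A∣ γ) V) (idh-commutes f) (rstT (A∣ γ) f t)

      El : Ty Γ ℓ
      El = record
        { ty      = λ W γ → ty (A∣ γ) W idh
        ; rstT    = El-rst
        ; rstT-id = λ {W} {γ} t → ≅-to-≡ (begin
            subst (λ γ' → ty (A∣ γ') W idh) (rst-id Γ γ) (El-rst idh t) ≅⟨ ≡-subst-removable (λ γ' → ty (A∣ γ') W idh) (rst-id Γ γ) _ ⟩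
            El-rst idh t                                                 ≅⟨ El-rst≅ idh t ⟩
            rstT (A∣ γ) idh t                                            ≅⟨ rstT-id≅ (A∣ γ) t ⟩
            t                                                            ∎)
        ; rstT-∘  = λ {U} f g {γ} t → ≅-to-≡ (begin
            subst (λ γ' → ty (A∣ γ') U idh) (rst-∘ Γ f g γ) (El-rst (f ∘h g) t) ≅⟨ ≡-subst-removable (λ γ' → ty (A∣ γ') U idh) (rst-∘ Γ f g γ) _ ⟩
            El-rst (f ∘h g) t                                                    ≅⟨ El-rst≅ (f ∘h g) t ⟩
            rstT (A∣ γ) (f ∘h g) t                                               ≅⟨ rstT-∘≅ (A∣ γ) f g t ⟩
            rstT (A∣ γ) g (rstT (A∣ γ) f t)                                      ≅⟨ El-rst-rst f g t ⟨
            El-rst g (El-rst f t)                                                ∎)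
        }
        where open H.≅-Reasoning

      -- Over γ = (\ i)·γ', the type A∣ γ is A∣ γ' reindexed along y (\ i),
      -- and the identity of y(W, i) is sent to the degenerate point (\ i).
      El-fixed : DegFixed El
      El-fixed i .(rst Γ (wkP i) γ') (γ' , refl) t = H.trans (El-rst-rst (secP i) (wkP i) t) (A∣-fixed t)
        where
        A∣-fixed : FixedAt (A∣ (rst Γ (wkP i) γ')) i idh
        A∣-fixed = subst (λ T → FixedAt T i idh) (sym (A∣-rst (wkP i) γ'))
                     (FixedAt-sub (yf (wkP i)) (A∣ γ') (proj₂ (tm A γ') i (wkP i ∘h idh) (idh , idh-commutes (wkP i))))

      El-disc : Discrete El
      El-disc = degFixed⇒discrete El El-fixed

    code : ∀ {c} {Γ : Ctx c} (T : Ty Γ ℓ) → Discrete T → Tm Γ (U Γ)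
    code {Γ = Γ} T discrete = record
      { tm     = λ γ → T [ χ γ ]T , DegFixed-sub (χ γ) T (discrete⇒degFixed T discrete)
      ; tm-rst = λ f γ → DiscTyʸ-≡ (trans (sym ([]-∘ T (χ γ) (yf f))) ([]-cong T (λ h → rst-∘ Γ f h γ)))
      }

    -- El of a code: the fibre of T [ χ γ ]T over idh is T over idh·γ = γ.
    El-code : ∀ {c} {Γ : Ctx c} (T : Ty Γ ℓ) (d : Discrete T) → El (code T d) ≅Ty T
    El-code {Γ = Γ} T d = record
      { fib     = λ W γ → cong (ty T W) (rst-id Γ γ)
      ; fib-rst = λ {V} {W} f {γ} t → ≅-to-≡ (begin
          coe (cong (ty T V) (rst-id Γ (rst Γ f γ))) (El-rst (code T d) f t) ≅⟨ ≡-subst-removable (λ X → X) (cong (ty T V) (rst-id Γ (rst Γ f γ))) _ ⟩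
          El-rst (code T d) f t                                            ≅⟨ El-rst≅ (code T d) f t ⟩
          rstT (T [ χ γ ]T) f t                                            ≅⟨ rstT-[]≅ T (χ γ) f t ⟩
          rstT T f t                                                       ≅⟨ rstT-cong T f (sym (rst-id Γ γ)) (≡-subst-removable (λ X → X) (cong (ty T W) (rst-id Γ γ)) t) ⟨
          rstT T f (coe (cong (ty T W) (rst-id Γ γ)) t)                    ∎)
      }
      where open H.≅-Reasoning

    El-classified : ∀ {c} {Γ : Ctx c} (A : Tm Γ (U Γ)) {W} (γ : ob Γ W) → El A [ χ γ ]T ≡ A∣ A γ
    El-classified {Γ = Γ} A γ = Ty-≡ fibres restrictions
      where
      fibres : ∀ V (h : Hom V _) → ty (A∣ A (rst Γ h γ)) V idh ≡ ty (A∣ A γ) V h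
      fibres V h = trans (cong (λ T → ty T V idh) (A∣-rst A h γ)) (cong (ty (A∣ A γ) V) (∘h-identityʳ h))

      restrictions : ∀ {U V} (k : Hom U V) {h : Hom V _} (t : ty (A∣ A (rst Γ h γ)) V idh) (t' : ty (A∣ A γ) V h) →
                     t ≅ t' → rstT (El A [ χ γ ]T) k t ≅ rstT (A∣ A γ) k t'
      restrictions {V = V} k {h} t t' t≅t' = begin
        rstT (El A [ χ γ ]T) k t      ≅⟨ rstT-[]≅ (El A) (χ γ) k t ⟩
        El-rst A k t                  ≅⟨ El-rst≅ A k t ⟩
        rstT (A∣ A (rst Γ h γ)) k t   ≅⟨ rstT-cong-ty k (A∣-rst A h γ) (H.sym (≡-subst-removable (λ T → ty T V idh) (A∣-rst A h γ) t)) ⟩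
        rstT (A∣ A γ [ yf h ]T) k t₁  ≅⟨ rstT-[]≅ (A∣ A γ) (yf h) k t₁ ⟩
        rstT (A∣ A γ) k t₁            ≅⟨ rstT-cong (A∣ A γ) k (∘h-identityʳ h) (H.trans (≡-subst-removable (λ T → ty T V idh) (A∣-rst A h γ) t) t≅t') ⟩
        rstT (A∣ A γ) k t'            ∎
        where
        open H.≅-Reasoning
        t₁ : ty (A∣ A γ [ yf h ]T) V idh
        t₁ = subst (λ T → ty T V idh) (A∣-rst A h γ) t

    code-El : ∀ {c} {Γ : Ctx c} (A : Tm Γ (U Γ)) → code (El A) (El-disc A) ≈Tm A
    code-El A W γ = DiscTyʸ-≡ (El-classified A γ)

    -- El commutes with substitution on the nose: both sides restrict in A∣ (σ δ).
    El-sub : ∀ {c d} {Γ : Ctx c} {Δ : Ctx d} (σ : Sub Δ Γ) (A : Tm Γ (U Γ)) →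
             (El A [ σ ]T) ≅Ty El (transp (A [ σ ]t) (U-sub σ))
    El-sub σ A = record
      { fib     = λ W δ → refl
      ; fib-rst = λ f {δ} t → ≅-to-≡ (H.trans (rstT-[]≅ (El A) σ f t)
                                     (H.trans (El-rst≅ A f t) (H.sym (El-rst≅ (transp (A [ σ ]t) (U-sub σ)) f t))))
      }

    -- Classifying maps commute with substitution: χ (σ δ) = σ ∘ χ δ.
    code-sub : ∀ {c d} {Γ : Ctx c} {Δ : Ctx d} (σ : Sub Δ Γ) (T : Ty Γ ℓ)
               (dT : Discrete T) (dTσ : Discrete (T [ σ ]T)) →
               transp (code T dT [ σ ]t) (U-sub σ) ≈Tm code (T [ σ ]T) dTσ
    code-sub σ T dT dTσ W δ = DiscTyʸ-≡ (trans ([]-cong T (λ h → sym (nat σ h δ))) ([]-∘ T σ (χ δ)))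

    universe : DiscUniverse ℓ
    universe = record
      { uℓ = lsuc ℓ ; U = U ; U-sub = U-sub ; El = El ; El-disc = El-disc ; code = code
      ; El-code = El-code ; code-El = code-El ; El-sub = El-sub ; code-sub = code-sub }

proposition4p39 : (∀ {a b} → Extensionality a b) → (ℓ : Level) → DiscUniverse ℓ
proposition4p39 ext ℓ = WithExtensionality.Universe.universe ext ℓ
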